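{- There are distinct integers $a,u,s\in[0,2^{21}]$ and a set $I''\subseteq[0,2^{21}]$ such that, writing $I'=\{a,u,s-a,s-u\}$, the following hold: (i) $I'$ and $I''$ are disjoint and $I=I'\cup I''$ is primitive; (ii) $r_{I+I}(2a)=r_{I+I}(2s-2a)=r_{I+I}(2s-2u)=1$ and $r_{I+I}(s)=4$; (iii) $(I'+I')\setminus\{2a,\,2s-2a,\,2s-2u,\,s\}\subseteq I''+I''$.
   Context: $[x,y]=\{x,x+1,\dots,y\}$ for integers $x<y$. For sets $A,B\subseteq\mathbb{Z}$, $A+B=\{a+b:a\in A,b\in B\}$, and $r_{A+B}(x)=|\{(a,b)\in A\times B: a+b=x\}|$ is the number of (ordered) representations of $x$. A set $A$ in an abelian group is called primitive if whenever $A+A=B+B$ for some set $B$, then $B=A+x$ for some group element $x$ with $2x=0$ (over $\mathbb{Z}$ this means $B=A$). -}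

module Defs where

import Data.Nat
open import Data.Integer using (ℤ; _+_; _-_)
open import Data.Integer.Properties using (_≟_)
open import Data.List using (List; length; filter; cartesianProduct; deduplicate)
open import Data.List.Membership.Propositional using (_∈_)
open import Data.Product using (_×_; _,_; proj₁; proj₂; ∃-syntax)
open import Function.Bundles using (_⇔_)
open import Relation.Binary.PropositionalEquality using (_≡_)

SubsetZ : Set₁
SubsetZ = ℤ → Set

_⊕_ : SubsetZ → SubsetZ → SubsetZ
(A ⊕ B) x = ∃[ a ] ∃[ b ] (A a × B b × a + b ≡ x)

setOf : List ℤ → SubsetZ
setOf L x = x ∈ L

Primitive : SubsetZ → Set₁
Primitive A = (B : SubsetZ) → (∀ x → (A ⊕ A) x ⇔ (B ⊕ B) x) → ∀ x → B x ⇔ A x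

r : List ℤ → ℤ → Data.Nat.ℕ
r L x = length (filter (λ p → (proj₁ p + proj₂ p) ≟ x) (cartesianProduct D D))
  where D = deduplicate _≟_ L

module Submission where

-- Witness: a = 8, u = 19, s = 21, I'' = {5, 10, 15, 22, 33, 35}; apart from
-- primitivity everything is a finite computation. For primitivity of I, let
-- B + B = I + I. Comparing b + b with the sums of I shows that B lies between
-- m = min I and M = max I, and then 2m and 2M force m, M ∈ B. Each b ∈ B gives
-- b + m ∈ I + I, so b = i + j - m for some i, j ∈ I, and a check over these
-- candidates shows b ∈ I (the others fail 2b ∈ I + I or b + M ∈ I + I). Conversely
-- every x ∈ I has a partner y ∈ I such that every representation of x + y in
-- I + I uses x, and B ⊆ I then forces x ∈ B.

open import Defs
open import Data.Nat using (ℕ; _^_)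
open import Data.Integer using (ℤ; +_; _+_; _-_; _*_; _≤_)
open import Data.List using (List; _∷_; _++_)
open import Data.List.Relation.Unary.All using (All)
open import Data.List.Membership.Propositional using (_∈_; _∉_)
open import Data.Product using (_×_; ∃-syntax)
open import Relation.Binary.PropositionalEquality using (_≡_; _≢_)

open import Algebra.Bundles using (AbelianGroup)
open import Data.Empty using (⊥-elim)
open import Data.Integer.Properties
  using (_≟_; _≤?_; ≤-antisym; <-irrefl; <⇒≱; ≰⇒>; +-mono-≤; +-mono-<; +-mono-<-≤; +-0-abelianGroup)
open import Algebra.Properties.Group (AbelianGroup.group +-0-abelianGroup) using (//-rightDividesʳ)
open import Data.List using (cartesianProductWith)
open import Data.List.Relation.Unary.All using (all?; lookup)
open import Data.List.Relation.Unary.Any using (Any; here; there; any?)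
open import Data.List.Membership.DecPropositional _≟_ using (_∈?_)
open import Data.List.Membership.Propositional using (find)
open import Data.List.Membership.Propositional.Properties
  using (∈-cartesianProductWith⁺; ∈-cartesianProductWith⁻)
open import Data.Product using (_,_)
open import Data.Sum using (_⊎_; inj₁; inj₂)
open import Data.Unit using (tt)
open import Relation.Nullary using (Dec; yes; no; ¬?)
open import Relation.Nullary.Decidable using (toWitness; _⊎-dec_; _×-dec_)
open import Relation.Binary.PropositionalEquality using (refl; sym; trans; cong; subst)
open import Function.Bundles using (_⇔_; mk⇔; Equivalence)

+-double-cancel-≤ : ∀ {i j} → i + i ≤ j + j → i ≤ j
+-double-cancel-≤ {i} {j} i+i≤j+j with i ≤? j
... | yes i≤j = i≤j
... | no  i≰j = ⊥-elim (<⇒≱ (+-mono-< (≰⇒> i≰j) (≰⇒> i≰j)) i+i≤j+j)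

summand-≡-lower-bound : ∀ {m i j} → m ≤ i → m ≤ j → i + j ≡ m + m → i ≡ m
summand-≡-lower-bound {m} {i} m≤i m≤j i+j≡m+m with i ≤? m
... | yes i≤m = ≤-antisym i≤m m≤i
... | no  i≰m = ⊥-elim (<-irrefl (sym i+j≡m+m) (+-mono-<-≤ (≰⇒> i≰m) m≤j))

summand-≡-upper-bound : ∀ {M i j} → i ≤ M → j ≤ M → i + j ≡ M + M → i ≡ M
summand-≡-upper-bound {M} {i} i≤M j≤M i+j≡M+M with M ≤? i
... | yes M≤i = ≤-antisym i≤M M≤i
... | no  M≰i = ⊥-elim (<-irrefl i+j≡M+M (+-mono-<-≤ (≰⇒> M≰i) j≤M))

sumList : List ℤ → List ℤ
sumList I = cartesianProductWith _+_ I I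

⊕⇔∈-sumList : ∀ I {x} → (setOf I ⊕ setOf I) x ⇔ x ∈ sumList I
⊕⇔∈-sumList I = mk⇔ to from
  where
  to : ∀ {x} → (setOf I ⊕ setOf I) x → x ∈ sumList I
  to (i , j , i∈I , j∈I , refl) = ∈-cartesianProductWith⁺ _+_ i∈I j∈I
  from : ∀ {x} → x ∈ sumList I → (setOf I ⊕ setOf I) x
  from x∈ with ∈-cartesianProductWith⁻ _+_ I I x∈
  ... | i , j , i∈I , j∈I , refl = i , j , i∈I , j∈I , refl

-- If t and M both lie in a set B with B + B = I + I, then t ∈ I.
Confined : List ℤ → ℤ → ℤ → Set
Confined I M t = t ∈ I ⊎ t + t ∉ sumList I ⊎ t + M ∉ sumList I

confined? : ∀ I M t → Dec (Confined I M t)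
confined? I M t = (t ∈? I) ⊎-dec ¬? (t + t ∈? sumList I) ⊎-dec ¬? (t + M ∈? sumList I)

EveryRepresentationUses : List ℤ → ℤ → ℤ → Set
EveryRepresentationUses I x n = All (λ i → All (λ j → i + j ≢ n ⊎ i ≡ x ⊎ j ≡ x) I) I

everyRepresentationUses? : ∀ I x n → Dec (EveryRepresentationUses I x n)
everyRepresentationUses? I x n =
  all? (λ i → all? (λ j → ¬? (i + j ≟ n) ⊎-dec (i ≟ x) ⊎-dec (j ≟ x)) I) I

module SameSumset (I : List ℤ) (B : SubsetZ)
                  (I+I⇔B+B : ∀ x → (setOf I ⊕ setOf I) x ⇔ (B ⊕ B) x) where

  B+B⇒sumList : ∀ {x} → (B ⊕ B) x → x ∈ sumList I
  B+B⇒sumList p = Equivalence.to (⊕⇔∈-sumList I) (Equivalence.from (I+I⇔B+B _) p)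

  lower-bound : ∀ {m b} → All (m ≤_) I → B b → m ≤ b
  lower-bound {m} {b} m≤I b∈B with Equivalence.from (I+I⇔B+B (b + b)) (b , b , b∈B , b∈B , refl)
  ... | i , j , i∈I , j∈I , i+j≡2b =
    +-double-cancel-≤ (subst (m + m ≤_) i+j≡2b (+-mono-≤ (lookup m≤I i∈I) (lookup m≤I j∈I)))

  upper-bound : ∀ {M b} → All (_≤ M) I → B b → b ≤ M
  upper-bound {M} {b} I≤M b∈B with Equivalence.from (I+I⇔B+B (b + b)) (b , b , b∈B , b∈B , refl)
  ... | i , j , i∈I , j∈I , i+j≡2b =
    +-double-cancel-≤ (subst (_≤ M + M) i+j≡2b (+-mono-≤ (lookup I≤M i∈I) (lookup I≤M j∈I)))

  minimum-∈ : ∀ {m} → m ∈ I → All (m ≤_) I → B m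
  minimum-∈ {m} m∈I m≤I with Equivalence.to (I+I⇔B+B (m + m)) (m , m , m∈I , m∈I , refl)
  ... | b₁ , b₂ , b₁∈B , b₂∈B , eq =
    subst B (summand-≡-lower-bound (lower-bound m≤I b₁∈B) (lower-bound m≤I b₂∈B) eq) b₁∈B

  maximum-∈ : ∀ {M} → M ∈ I → All (_≤ M) I → B M
  maximum-∈ {M} M∈I I≤M with Equivalence.to (I+I⇔B+B (M + M)) (M , M , M∈I , M∈I , refl)
  ... | b₁ , b₂ , b₁∈B , b₂∈B , eq =
    subst B (summand-≡-upper-bound (upper-bound I≤M b₁∈B) (upper-bound I≤M b₂∈B) eq) b₁∈B

  B⊆I : ∀ {m M} → B m → B M → All (λ i → All (λ j → Confined I M (i + j - m)) I) I
      → ∀ {b} → B b → b ∈ I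
  B⊆I {m} {M} m∈B M∈B confined {b} b∈B
    with Equivalence.from (I+I⇔B+B (b + m)) (b , m , b∈B , m∈B , refl)
  ... | i , j , i∈I , j∈I , i+j≡b+m
    with subst (Confined I M) (trans (cong (_- m) i+j≡b+m) (//-rightDividesʳ m b))
               (lookup (lookup confined i∈I) j∈I)
  ... | inj₁ b∈I = b∈I
  ... | inj₂ (inj₁ 2b∉) = ⊥-elim (2b∉ (B+B⇒sumList (b , b , b∈B , b∈B , refl)))
  ... | inj₂ (inj₂ b+M∉) = ⊥-elim (b+M∉ (B+B⇒sumList (b , M , b∈B , M∈B , refl)))

  I⊆B : (∀ {b} → B b → b ∈ I)
      → All (λ x → Any (λ y → EveryRepresentationUses I x (x + y)) I) I
      → ∀ {x} → x ∈ I → B x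
  I⊆B B⊆I pinned {x} x∈I with find (lookup pinned x∈I)
  ... | y , y∈I , uses
    with Equivalence.to (I+I⇔B+B (x + y)) (x , y , x∈I , y∈I , refl)
  ... | b₁ , b₂ , b₁∈B , b₂∈B , eq
    with lookup (lookup uses (B⊆I b₁∈B)) (B⊆I b₂∈B)
  ... | inj₁ ≢x+y = ⊥-elim (≢x+y eq)
  ... | inj₂ (inj₁ b₁≡x) = subst B b₁≡x b₁∈B
  ... | inj₂ (inj₂ b₂≡x) = subst B b₂≡x b₂∈B

primitive-criterion : ∀ I {m M} → m ∈ I → M ∈ I → All (m ≤_) I → All (_≤ M) I
  → All (λ i → All (λ j → Confined I M (i + j - m)) I) I
  → All (λ x → Any (λ y → EveryRepresentationUses I x (x + y)) I) I
  → Primitive (setOf I)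
primitive-criterion I m∈I M∈I m≤I I≤M confined pinned B I+I⇔B+B x =
  mk⇔ B⊆I′ (I⊆B B⊆I′ pinned)
  where
  open SameSumset I B I+I⇔B+B
  B⊆I′ : ∀ {b} → B b → b ∈ I
  B⊆I′ = B⊆I (minimum-∈ m∈I m≤I) (maximum-∈ M∈I I≤M) confined

sumset-covered-outside : ∀ J K E → All (λ i → All (λ j → i + j ∈ E ⊎ i + j ∈ sumList K) J) J
  → ∀ {x} → (setOf J ⊕ setOf J) x → x ∉ E → (setOf K ⊕ setOf K) x
sumset-covered-outside J K E covered (i , j , i∈J , j∈J , refl) x∉E
  with lookup (lookup covered i∈J) j∈J
... | inj₁ x∈E = ⊥-elim (x∉E x∈E)
... | inj₂ x∈K+K = Equivalence.from (⊕⇔∈-sumList K) x∈K+K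

I′ I″ I : List ℤ
I′ = + 8 ∷ + 19 ∷ (+ 21 - + 8) ∷ (+ 21 - + 19) ∷ List.[]
I″ = + 5 ∷ + 10 ∷ + 15 ∷ + 22 ∷ + 33 ∷ + 35 ∷ List.[]
I = I′ ++ I″

InRange : ℤ → Set
InRange x = + 0 ≤ x × x ≤ + (2 ^ 21)

inRange? : ∀ x → Dec (InRange x)
inRange? x = (+ 0 ≤? x) ×-dec (x ≤? + (2 ^ 21))

lemma3p1 : ∃[ a ] ∃[ u ] ∃[ s ] ∃[ I'' ]
    ( a ≢ u × a ≢ s × u ≢ s
    × (+ 0 ≤ a × a ≤ + (2 ^ 21)) × (+ 0 ≤ u × u ≤ + (2 ^ 21)) × (+ 0 ≤ s × s ≤ + (2 ^ 21))
    × All (λ x → + 0 ≤ x × x ≤ + (2 ^ 21)) I''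
    × (∀ x → x ∈ (a ∷ u ∷ (s - a) ∷ (s - u) ∷ List.[]) → x ∉ I'')
    × Primitive (setOf ((a ∷ u ∷ (s - a) ∷ (s - u) ∷ List.[]) ++ I''))
    × r ((a ∷ u ∷ (s - a) ∷ (s - u) ∷ List.[]) ++ I'') (+ 2 * a) ≡ 1
    × r ((a ∷ u ∷ (s - a) ∷ (s - u) ∷ List.[]) ++ I'') (+ 2 * s - + 2 * a) ≡ 1
    × r ((a ∷ u ∷ (s - a) ∷ (s - u) ∷ List.[]) ++ I'') (+ 2 * s - + 2 * u) ≡ 1
    × r ((a ∷ u ∷ (s - a) ∷ (s - u) ∷ List.[]) ++ I'') s ≡ 4
    × (∀ x → (setOf (a ∷ u ∷ (s - a) ∷ (s - u) ∷ List.[]) ⊕ setOf (a ∷ u ∷ (s - a) ∷ (s - u) ∷ List.[])) x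
    → x ≢ + 2 * a → x ≢ + 2 * s - + 2 * a → x ≢ + 2 * s - + 2 * u → x ≢ s
    → (setOf I'' ⊕ setOf I'') x) )
lemma3p1 = + 8 , + 19 , + 21 , I″ ,
  (λ ()) , (λ ()) , (λ ()) ,
  toWitness {a? = inRange? (+ 8)} tt , toWitness {a? = inRange? (+ 19)} tt ,
  toWitness {a? = inRange? (+ 21)} tt , toWitness {a? = all? inRange? I″} tt ,
  (λ x → lookup (toWitness {a? = all? (λ y → ¬? (y ∈? I″)) I′} tt)) ,
  primitive-criterion I (toWitness {a? = + 2 ∈? I} tt) (toWitness {a? = + 35 ∈? I} tt)
    (toWitness {a? = all? (+ 2 ≤?_) I} tt) (toWitness {a? = all? (_≤? + 35) I} tt)
    (toWitness {a? = all? (λ i → all? (λ j → confined? I (+ 35) (i + j - + 2)) I) I} tt)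
    (toWitness {a? = all? (λ x → any? (λ y → everyRepresentationUses? I x (x + y)) I) I} tt) ,
  refl , refl , refl , refl ,
  λ x x∈I′+I′ x≢16 x≢26 x≢4 x≢21 →
    sumset-covered-outside I′ I″ (+ 16 ∷ + 26 ∷ + 4 ∷ + 21 ∷ List.[])
      (toWitness {a? = all? (λ i → all? (λ j → (i + j ∈? (+ 16 ∷ + 26 ∷ + 4 ∷ + 21 ∷ List.[]))
                                               ⊎-dec (i + j ∈? sumList I″)) I′) I′} tt)
      x∈I′+I′
      λ { (here x≡16) → x≢16 x≡16 ; (there (here x≡26)) → x≢26 x≡26
        ; (there (there (here x≡4))) → x≢4 x≡4 ; (there (there (there (here x≡21)))) → x≢21 x≡21 }
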